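{- Let $G$ be a quasi-threshold graph. Then: (a) every maximal clique of $G$ contains at least one simplicial vertex of $G$; (b) for every maximal clique $Q$ of $G$, the minimal vertex separators of $G$ contained in $Q$ form (at most) one chain, i.e. they are totally ordered by inclusion.
   Context: All graphs are finite, simple and undirected. Quasi-threshold graphs are defined recursively: (i) a single isolated vertex is a quasi-threshold graph; (ii) adding to a quasi-threshold graph a new vertex adjacent to all of its vertices gives a quasi-threshold graph; (iii) the disjoint union of two quasi-threshold graphs is a quasi-threshold graph. (Equivalently, they are the graphs with no induced $P_4$ and no induced $C_4$.) A clique is a set of pairwise adjacent vertices; a vertex $v$ is simplicial if its neighbourhood $N(v)$ is a clique. For non-adjacent vertices $u,v$, a set $S\subset V$ is a $uv$-separator if $u$ and $v$ lie in distinct connected components of $G[V\setminus S]$; it is a minimal $uv$-separator if no proper subset of $S$ is a $uv$-separator. A minimal vertex separator is a set that is a minimal $uv$-separator for some pair of non-adjacent vertices $u,v$. A chain is a collection of sets any two of which are comparable under inclusion. -}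

module Defs where

open import Data.Nat using (ℕ; zero; suc; _+_)
open import Data.Bool using (Bool; true; false)
open import Data.Fin using (Fin; zero; suc; splitAt)
open import Data.Fin.Subset using (Subset; _∈_; _∉_; _⊆_)
open import Data.Vec using (tabulate)
open import Data.Sum using (_⊎_; inj₁; inj₂)
open import Data.Product using (Σ; _×_; ∃; ∃-syntax)
open import Relation.Binary.PropositionalEquality using (_≡_; _≢_)
open import Relation.Nullary using (¬_)
open import Function.Bundles using (_↔_; Inverse)

-- A (finite, simple, undirected) graph on the vertex set Fin n is given by
-- its adjacency function.  Every quasi-threshold graph (below) is
-- automatically symmetric and loopless.
Graph : ℕ → Set
Graph n = Fin n → Fin n → Bool

Adj : ∀ {n} → Graph n → Fin n → Fin n → Set
Adj G u v = G u v ≡ true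

K1 : Graph 1
K1 _ _ = false

cone : ∀ {n} → Graph n → Graph (suc n)
cone G zero    zero    = false
cone G zero    (suc _) = true
cone G (suc _) zero    = true
cone G (suc u) (suc v) = G u v

union : ∀ {m k} → Graph m → Graph k → Graph (m + k)
union {m} G H u v with splitAt m u | splitAt m v
... | inj₁ a | inj₁ b = G a b
... | inj₂ a | inj₂ b = H a b
... | inj₁ _ | inj₂ _ = false
... | inj₂ _ | inj₁ _ = false

record _≅_ {m n} (G : Graph m) (H : Graph n) : Set where
  field
    bij      : Fin m ↔ Fin n
    preserve : ∀ u v → H (Inverse.to bij u) (Inverse.to bij v) ≡ G u v

-- Quasi-threshold graphs, defined recursively (closed under isomorphism,
-- as graph classes are).
data QuasiThreshold : ∀ {n} → Graph n → Set where
  qt-single : QuasiThreshold K1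
  qt-cone   : ∀ {n} {G : Graph n} → QuasiThreshold G → QuasiThreshold (cone G)
  qt-union  : ∀ {m k} {G : Graph m} {H : Graph k} →
              QuasiThreshold G → QuasiThreshold H → QuasiThreshold (union G H)
  qt-iso    : ∀ {m n} {G : Graph m} {H : Graph n} →
              G ≅ H → QuasiThreshold G → QuasiThreshold H

module _ {n : ℕ} (G : Graph n) where

  IsClique : Subset n → Set
  IsClique Q = ∀ {u v} → u ∈ Q → v ∈ Q → u ≢ v → Adj G u v

  IsMaximalClique : Subset n → Set
  IsMaximalClique Q = IsClique Q × (∀ Q′ → IsClique Q′ → Q ⊆ Q′ → Q′ ⊆ Q)

  N : Fin n → Subset n
  N v = tabulate (G v)

  IsSimplicial : Fin n → Set
  IsSimplicial v = IsClique (N v)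

  -- Conn S u v : u and v lie in the same connected component of G[V ∖ S].
  data Conn (S : Subset n) : Fin n → Fin n → Set where
    here : ∀ {u} → u ∉ S → Conn S u u
    step : ∀ {u w v} → u ∉ S → Adj G u w → Conn S w v → Conn S u v

  IsSeparator : Subset n → Fin n → Fin n → Set
  IsSeparator S u v = u ∉ S × v ∉ S × ¬ Conn S u v

  IsMinimalSeparator : Subset n → Fin n → Fin n → Set
  IsMinimalSeparator S u v =
    IsSeparator S u v ×
    (∀ S′ → S′ ⊆ S → ¬ (S ⊆ S′) → ¬ IsSeparator S′ u v)

  IsMinimalVertexSeparator : Subset n → Set
  IsMinimalVertexSeparator S =
    ∃[ u ] ∃[ v ] (u ≢ v × ¬ Adj G u v × IsMinimalSeparator S u v)

-- Quasi-threshold graphs have nested closed neighbourhoods: for every edge st,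
-- N[s] ⊆ N[t] or N[t] ⊆ N[s], a property preserved by cones, disjoint unions and
-- isomorphisms.  Hence the closed neighbourhoods of the vertices of a clique Q form
-- a chain.
-- (a) If c ∈ Q has the least closed neighbourhood, every neighbour of c is in N[x]
-- for all x ∈ Q, so by maximality N(c) ⊆ Q and c is simplicial.
-- (b) If minimal separators S, T ⊆ Q were incomparable, take s ∈ S ∖ T and
-- t ∈ T ∖ S; they are adjacent, say N[s] ⊆ N[t].  Any path avoiding S ∖ {s} then
-- becomes one avoiding S by replacing s with t, so S ∖ {s} is still a separator,
-- contradicting the minimality of S.
module Submission where

open import Defs
open import Data.Nat using (ℕ)
open import Data.Bool using (true; false)
open import Data.Empty using (⊥; ⊥-elim)
open import Data.Fin using (Fin; zero; suc; splitAt; _↑ˡ_; _↑ʳ_)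
open import Data.Fin.Properties
  using (splitAt-↑ˡ; splitAt-↑ʳ; splitAt⁻¹-↑ˡ; splitAt⁻¹-↑ʳ; ¬∀⟶∃¬)
  renaming (_≟_ to _≟ᶠ_)
open import Data.Fin.Subset using (Subset; _∈_; _∉_; _⊆_; _⊈_; _∪_; _-_; ⁅_⁆; Nonempty)
open import Data.Fin.Subset.Properties
  using (_∈?_; _⊆?_; nonempty?; x∈⁅x⁆; x∈⁅y⁆⇒x≡y; p⊆p∪q; x∈p∪q⁺; x∈p∪q⁻;
         x∈p∧x≢y⇒x∈p-y; x∈p⇒p-x⊂p)
open import Data.List using (List; []; _∷_; allFin)
open import Data.List.Relation.Unary.All as All using (All; []; _∷_)
open import Data.List.Membership.Propositional.Properties using (∈-allFin)
open import Data.Product using (_×_; _,_; proj₁; ∃; ∃-syntax)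
open import Data.Sum as Sum using (_⊎_; inj₁; inj₂)
open import Data.Vec.Properties using ([]=⇒lookup; lookup∘tabulate)
open import Function using (id; _∘_; case_of_)
open import Function.Bundles using (Inverse)
open import Relation.Binary.Core using (Rel)
open import Relation.Binary.Definitions using (Reflexive; Transitive)
open import Relation.Binary.PropositionalEquality
  using (_≡_; _≢_; refl; sym; trans; cong; subst₂)
open import Relation.Nullary using (yes; no)
open import Relation.Nullary.Decidable using (_→-dec_)
open import Relation.Unary using (Pred; Decidable)

Symmetric : ∀ {n} → Graph n → Set
Symmetric G = ∀ u v → Adj G u v → Adj G v u

_⊢_∈N[_] : ∀ {n} → Graph n → Fin n → Fin n → Set
G ⊢ w ∈N[ a ] = w ≡ a ⊎ Adj G a w

_⊢_≼_ : ∀ {n} → Graph n → Fin n → Fin n → Set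
G ⊢ a ≼ b = ∀ {w} → G ⊢ w ∈N[ a ] → G ⊢ w ∈N[ b ]

NestedNeighbourhoods : ∀ {n} → Graph n → Set
NestedNeighbourhoods G = ∀ s t → Adj G s t → G ⊢ s ≼ t ⊎ G ⊢ t ≼ s

false≢true : false ≢ true
false≢true ()

module _ {n} {G : Graph n} where

  cone-symmetric : Symmetric G → Symmetric (cone G)
  cone-symmetric G-sym zero    (suc v) _ = refl
  cone-symmetric G-sym (suc u) zero    _ = refl
  cone-symmetric G-sym (suc u) (suc v) e = G-sym u v e

  apex-≼ : ∀ v → cone G ⊢ v ≼ zero
  apex-≼ v {zero}  _ = inj₁ refl
  apex-≼ v {suc w} _ = inj₂ refl

  cone-≼ : ∀ {s t} → G ⊢ s ≼ t → cone G ⊢ suc s ≼ suc t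
  cone-≼ s≼t {zero}  _           = inj₂ refl
  cone-≼ s≼t {suc w} (inj₁ refl) = Sum.map (cong suc) id (s≼t (inj₁ refl))
  cone-≼ s≼t {suc w} (inj₂ e)    = Sum.map (cong suc) id (s≼t (inj₂ e))

  cone-nested : NestedNeighbourhoods G → NestedNeighbourhoods (cone G)
  cone-nested nested zero    (suc t) _ = inj₂ (apex-≼ (suc t))
  cone-nested nested (suc s) zero    _ = inj₁ (apex-≼ (suc s))
  cone-nested nested (suc s) (suc t) e = Sum.map cone-≼ cone-≼ (nested s t e)

record ClosedEmbedding {m n} (G : Graph m) (H : Graph n) : Set where
  field
    embed      : Fin m → Fin n
    adj-embed  : ∀ a b → H (embed a) (embed b) ≡ G a b
    nbr-closed : ∀ {a w} → Adj H (embed a) w → ∃ λ c → embed c ≡ w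

module _ {m n} {G : Graph m} {H : Graph n} (ι : ClosedEmbedding G H) where
  open ClosedEmbedding ι

  embed-adj : ∀ {a b} → Adj G a b → Adj H (embed a) (embed b)
  embed-adj {a} {b} e = trans (adj-embed a b) e

  reflect-adj : ∀ {a b} → Adj H (embed a) (embed b) → Adj G a b
  reflect-adj {a} {b} e = trans (sym (adj-embed a b)) e

  embed-symmetric : Symmetric G → ∀ a v → Adj H (embed a) v → Adj H v (embed a)
  embed-symmetric G-sym a v e with nbr-closed e
  ... | c , refl = embed-adj (G-sym a c (reflect-adj e))

  embed-∈N : ∀ {a w} → H ⊢ w ∈N[ embed a ] → ∃ λ c → embed c ≡ w × G ⊢ c ∈N[ a ]
  embed-∈N {a} (inj₁ refl) = a , refl , inj₁ refl
  embed-∈N     (inj₂ e) with nbr-closed e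
  ... | c , refl = c , refl , inj₂ (reflect-adj e)

  embed-≼ : ∀ {a b} → G ⊢ a ≼ b → H ⊢ embed a ≼ embed b
  embed-≼ a≼b w∈N[a] with embed-∈N w∈N[a]
  ... | c , refl , c∈N[a] = Sum.map (cong embed) embed-adj (a≼b c∈N[a])

  embed-nested : NestedNeighbourhoods G →
    ∀ a v → Adj H (embed a) v → H ⊢ embed a ≼ v ⊎ H ⊢ v ≼ embed a
  embed-nested nested a v e with nbr-closed e
  ... | c , refl = Sum.map embed-≼ embed-≼ (nested a c (reflect-adj e))

module _ {m k} (G : Graph m) (H : Graph k) where

  union-↑ˡ↑ˡ : ∀ a b → union G H (a ↑ˡ k) (b ↑ˡ k) ≡ G a b
  union-↑ˡ↑ˡ a b rewrite splitAt-↑ˡ m a k | splitAt-↑ˡ m b k = refl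

  union-↑ʳ↑ʳ : ∀ a b → union G H (m ↑ʳ a) (m ↑ʳ b) ≡ H a b
  union-↑ʳ↑ʳ a b rewrite splitAt-↑ʳ m k a | splitAt-↑ʳ m k b = refl

  union-↑ˡ↑ʳ : ∀ a b → union G H (a ↑ˡ k) (m ↑ʳ b) ≡ false
  union-↑ˡ↑ʳ a b rewrite splitAt-↑ˡ m a k | splitAt-↑ʳ m k b = refl

  union-↑ʳ↑ˡ : ∀ a b → union G H (m ↑ʳ a) (b ↑ˡ k) ≡ false
  union-↑ʳ↑ˡ a b rewrite splitAt-↑ʳ m k a | splitAt-↑ˡ m b k = refl

  ↑ˡ-or-↑ʳ : ∀ w → (∃ λ a → a ↑ˡ k ≡ w) ⊎ (∃ λ b → m ↑ʳ b ≡ w)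
  ↑ˡ-or-↑ʳ w with splitAt m w in eq
  ... | inj₁ a = inj₁ (a , splitAt⁻¹-↑ˡ eq)
  ... | inj₂ b = inj₂ (b , splitAt⁻¹-↑ʳ eq)

  union-left : ClosedEmbedding G (union G H)
  union-left = record
    { embed      = _↑ˡ k
    ; adj-embed  = union-↑ˡ↑ˡ
    ; nbr-closed = λ {a} {w} e → case ↑ˡ-or-↑ʳ w of λ where
        (inj₁ p)          → p
        (inj₂ (b , refl)) → ⊥-elim (false≢true (trans (sym (union-↑ˡ↑ʳ a b)) e))
    }

  union-right : ClosedEmbedding H (union G H)
  union-right = record
    { embed      = m ↑ʳ_
    ; adj-embed  = union-↑ʳ↑ʳ
    ; nbr-closed = λ {a} {w} e → case ↑ˡ-or-↑ʳ w of λ where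
        (inj₁ (b , refl)) → ⊥-elim (false≢true (trans (sym (union-↑ʳ↑ˡ a b)) e))
        (inj₂ p)          → p
    }

  union-symmetric : Symmetric G → Symmetric H → Symmetric (union G H)
  union-symmetric G-sym H-sym u v e with ↑ˡ-or-↑ʳ u
  ... | inj₁ (a , refl) = embed-symmetric union-left  G-sym a v e
  ... | inj₂ (b , refl) = embed-symmetric union-right H-sym b v e

  union-nested : NestedNeighbourhoods G → NestedNeighbourhoods H →
                 NestedNeighbourhoods (union G H)
  union-nested G-nested H-nested s t e with ↑ˡ-or-↑ʳ s
  ... | inj₁ (a , refl) = embed-nested union-left  G-nested a t e
  ... | inj₂ (b , refl) = embed-nested union-right H-nested b t e

module _ {m n} {G : Graph m} {H : Graph n} (iso : G ≅ H) where
  open _≅_ iso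

  iso-onto : ∀ u → ∃ λ a → Inverse.to bij a ≡ u
  iso-onto u = Inverse.from bij u , Inverse.strictlyInverseˡ bij u

  iso-embedding : ClosedEmbedding G H
  iso-embedding = record
    { embed      = Inverse.to bij
    ; adj-embed  = preserve
    ; nbr-closed = λ {_} {w} _ → iso-onto w
    }

  iso-symmetric : Symmetric G → Symmetric H
  iso-symmetric G-sym u v e with iso-onto u
  ... | a , refl = embed-symmetric iso-embedding G-sym a v e

  iso-nested : NestedNeighbourhoods G → NestedNeighbourhoods H
  iso-nested G-nested s t e with iso-onto s
  ... | a , refl = embed-nested iso-embedding G-nested a t e

quasiThreshold⇒symmetric : ∀ {n} {G : Graph n} → QuasiThreshold G → Symmetric G
quasiThreshold⇒symmetric qt-single _ _ ()
quasiThreshold⇒symmetric (qt-cone q) = cone-symmetric (quasiThreshold⇒symmetric q)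
quasiThreshold⇒symmetric (qt-union {G = G} {H} q r) =
  union-symmetric G H (quasiThreshold⇒symmetric q) (quasiThreshold⇒symmetric r)
quasiThreshold⇒symmetric (qt-iso iso q) = iso-symmetric iso (quasiThreshold⇒symmetric q)

quasiThreshold⇒nested : ∀ {n} {G : Graph n} → QuasiThreshold G → NestedNeighbourhoods G
quasiThreshold⇒nested qt-single _ _ ()
quasiThreshold⇒nested (qt-cone q) = cone-nested (quasiThreshold⇒nested q)
quasiThreshold⇒nested (qt-union {G = G} {H} q r) =
  union-nested G H (quasiThreshold⇒nested q) (quasiThreshold⇒nested r)
quasiThreshold⇒nested (qt-iso iso q) = iso-nested iso (quasiThreshold⇒nested q)

quasiThreshold⇒vertex : ∀ {n} {G : Graph n} → QuasiThreshold G → Fin n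
quasiThreshold⇒vertex qt-single              = zero
quasiThreshold⇒vertex (qt-cone q)            = zero
quasiThreshold⇒vertex (qt-union {k = k} q r) = quasiThreshold⇒vertex q ↑ˡ k
quasiThreshold⇒vertex (qt-iso iso q)         = Inverse.to (_≅_.bij iso) (quasiThreshold⇒vertex q)

module _ {n} {G : Graph n} where

  Conn-map : ∀ {S S′} (f : Fin n → Fin n) →
    (∀ {x} → x ∉ S′ → f x ∉ S) →
    (∀ {x y} → Adj G x y → f x ≡ f y ⊎ Adj G (f x) (f y)) →
    ∀ {a b} → Conn G S′ a b → Conn G S (f a) (f b)
  Conn-map f avoid edge (here a∉S′) = here (avoid a∉S′)
  Conn-map {S} f avoid edge (step a∉S′ e c) with edge e
  ... | inj₁ fa≡fw = subst₂ (Conn G S) (sym fa≡fw) refl (Conn-map f avoid edge c)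
  ... | inj₂ e′    = step (avoid a∉S′) e′ (Conn-map f avoid edge c)

  module _ (G-sym : Symmetric G) {s t : Fin n} (s≼t : G ⊢ s ≼ t) where

    redirect : Fin n → Fin n
    redirect x with x ≟ᶠ s
    ... | yes _ = t
    ... | no  _ = x

    redirect-≢ : ∀ {x} → x ≢ s → redirect x ≡ x
    redirect-≢ {x} x≢s with x ≟ᶠ s
    ... | yes x≡s = ⊥-elim (x≢s x≡s)
    ... | no  _   = refl

    redirect-edge : ∀ {x y} → Adj G x y → redirect x ≡ redirect y ⊎ Adj G (redirect x) (redirect y)
    redirect-edge {x} {y} e with x ≟ᶠ s | y ≟ᶠ s
    ... | yes refl | yes refl = inj₁ refl
    ... | yes refl | no  _    = Sum.map sym id (s≼t (inj₂ e))
    ... | no  _    | yes refl = Sum.map id (G-sym t x) (s≼t (inj₂ (G-sym x s e)))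
    ... | no  _    | no  _    = inj₂ e

    separator-minus-≼ : ∀ {S u v} → s ∈ S → t ∉ S →
      IsSeparator G S u v → IsSeparator G (S - s) u v
    separator-minus-≼ {S} {u} {v} s∈S t∉S (u∉S , v∉S , ¬conn) =
      u∉S ∘ S-s⊆S , v∉S ∘ S-s⊆S ,
      λ conn → ¬conn (subst₂ (Conn G S) (redirect-≢ (≢s u∉S)) (redirect-≢ (≢s v∉S))
                        (Conn-map redirect avoid redirect-edge conn))
      where
      S-s⊆S : S - s ⊆ S
      S-s⊆S = proj₁ (x∈p⇒p-x⊂p s∈S)

      ≢s : ∀ {x} → x ∉ S → x ≢ s
      ≢s x∉S refl = x∉S s∈S

      avoid : ∀ {x} → x ∉ S - s → redirect x ∉ S
      avoid {x} x∉S-s with x ≟ᶠ s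
      ... | yes _   = t∉S
      ... | no  x≢s = x∉S-s ∘ λ x∈S → x∈p∧x≢y⇒x∈p-y x∈S x≢s

    minimalSeparator⇒¬≼ : ∀ {S u v} → IsMinimalSeparator G S u v → s ∈ S → t ∉ S → ⊥
    minimalSeparator⇒¬≼ {S} (sep , minimal) s∈S t∉S with x∈p⇒p-x⊂p s∈S
    ... | S-s⊆S , (x , x∈S , x∉S-s) =
      minimal (S - s) S-s⊆S (λ S⊆S-s → x∉S-s (S⊆S-s x∈S))
        (separator-minus-≼ s∈S t∉S sep)

⊈⇒∃∈∉ : ∀ {n} {p q : Subset n} → p ⊈ q → ∃ λ x → x ∈ p × x ∉ q
⊈⇒∃∈∉ {n} {p} {q} p⊈q
  with ¬∀⟶∃¬ n (λ x → x ∈ p → x ∈ q) (λ x → x ∈? p →-dec x ∈? q) (λ p⊆q → p⊈q (p⊆q _))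
... | x , x∈p↛x∈q with x ∈? p
...   | yes x∈p = x , x∈p , λ x∈q → x∈p↛x∈q (λ _ → x∈q)
...   | no  x∉p = ⊥-elim (x∈p↛x∈q (⊥-elim ∘ x∉p))

module _ {n} {G : Graph n} (G-sym : Symmetric G) (nested : NestedNeighbourhoods G) where

  minimalSeparators-in-clique-comparable : ∀ {Q S T} → IsClique G Q →
    IsMinimalVertexSeparator G S → S ⊆ Q →
    IsMinimalVertexSeparator G T → T ⊆ Q →
    S ⊆ T ⊎ T ⊆ S
  minimalSeparators-in-clique-comparable {S = S} {T} clique
    (_ , _ , _ , _ , S-minimal) S⊆Q (_ , _ , _ , _ , T-minimal) T⊆Q
    with S ⊆? T | T ⊆? S
  ... | yes S⊆T | _       = inj₁ S⊆T
  ... | no  _   | yes T⊆S = inj₂ T⊆S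
  ... | no  S⊈T | no  T⊈S with ⊈⇒∃∈∉ S⊈T | ⊈⇒∃∈∉ T⊈S
  ... | s , s∈S , s∉T | t , t∈T , t∉S
    with nested s t (clique (S⊆Q s∈S) (T⊆Q t∈T) λ { refl → t∉S s∈S })
  ... | inj₁ s≼t = ⊥-elim (minimalSeparator⇒¬≼ G-sym s≼t S-minimal s∈S t∉S)
  ... | inj₂ t≼s = ⊥-elim (minimalSeparator⇒¬≼ G-sym t≼s T-minimal t∈T s∉T)

module _ {a p ℓ} {A : Set a} {P : Pred A p} (P? : Decidable P)
         {_≤_ : Rel A ℓ} (≤-refl : Reflexive _≤_) (≤-trans : Transitive _≤_)
         (≤-total : ∀ {x y} → P x → P y → x ≤ y ⊎ y ≤ x) where

  least-in-list : ∀ {c} → P c → (xs : List A) → ∃ λ m → P m × All (λ u → P u → m ≤ u) xs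
  least-in-list Pc [] = _ , Pc , []
  least-in-list Pc (x ∷ xs) with least-in-list Pc xs | P? x
  ... | m , Pm , m≤xs | no ¬Px = m , Pm , (⊥-elim ∘ ¬Px) ∷ m≤xs
  ... | m , Pm , m≤xs | yes Px with ≤-total Pm Px
  ...   | inj₁ m≤x = m , Pm , (λ _ → m≤x) ∷ m≤xs
  ...   | inj₂ x≤m = x , Px , (λ _ → ≤-refl) ∷ All.map (λ m≤u Pu → ≤-trans x≤m (m≤u Pu)) m≤xs

∃-least : ∀ {n p ℓ} {P : Pred (Fin n) p} → Decidable P →
  {_≤_ : Rel (Fin n) ℓ} → Reflexive _≤_ → Transitive _≤_ →
  (∀ {x y} → P x → P y → x ≤ y ⊎ y ≤ x) →
  ∃ P → ∃ λ m → P m × ∀ {u} → P u → m ≤ u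
∃-least {n} P? ≤-refl ≤-trans ≤-total (c , Pc)
  with least-in-list P? ≤-refl ≤-trans ≤-total Pc (allFin n)
... | m , Pm , m≤all = m , Pm , λ {u} → All.lookup m≤all (∈-allFin u)

module _ {n} {G : Graph n} where

  ⁅⁆-clique : ∀ v → IsClique G ⁅ v ⁆
  ⁅⁆-clique v x∈⁅v⁆ y∈⁅v⁆ x≢y =
    ⊥-elim (x≢y (trans (x∈⁅y⁆⇒x≡y v x∈⁅v⁆) (sym (x∈⁅y⁆⇒x≡y v y∈⁅v⁆))))

  maximalClique-nonempty : Fin n → ∀ {Q} → IsMaximalClique G Q → Nonempty Q
  maximalClique-nonempty v {Q} (_ , maximal) with nonempty? Q
  ... | yes ne = ne
  ... | no  empty =
    v , maximal ⁅ v ⁆ (⁅⁆-clique v) (λ x∈Q → ⊥-elim (empty (_ , x∈Q))) (x∈⁅x⁆ v)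

  ∈N⇒Adj : ∀ {v w} → w ∈ N G v → Adj G v w
  ∈N⇒Adj {v} {w} w∈N = trans (sym (lookup∘tabulate (G v) w)) ([]=⇒lookup w∈N)

  maximalClique-absorbs : Symmetric G → ∀ {Q w} → IsMaximalClique G Q →
    (∀ {x} → x ∈ Q → G ⊢ w ∈N[ x ]) → w ∈ Q
  maximalClique-absorbs G-sym {Q} {w} (clique , maximal) near =
    maximal (Q ∪ ⁅ w ⁆) clique′ (p⊆p∪q ⁅ w ⁆) (x∈p∪q⁺ (inj₂ (x∈⁅x⁆ w)))
    where
    toward : ∀ {x} → x ∈ Q → x ≢ w → Adj G x w
    toward x∈Q x≢w with near x∈Q
    ... | inj₁ w≡x = ⊥-elim (x≢w (sym w≡x))
    ... | inj₂ e   = e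

    clique′ : IsClique G (Q ∪ ⁅ w ⁆)
    clique′ {x} {y} x∈ y∈ x≢y with x∈p∪q⁻ Q ⁅ w ⁆ x∈ | x∈p∪q⁻ Q ⁅ w ⁆ y∈
    ... | inj₁ x∈Q   | inj₁ y∈Q   = clique x∈Q y∈Q x≢y
    ... | inj₂ x∈⁅w⁆ | inj₂ y∈⁅w⁆ = ⁅⁆-clique w x∈⁅w⁆ y∈⁅w⁆ x≢y
    ... | inj₁ x∈Q   | inj₂ y∈⁅w⁆ with refl ← x∈⁅y⁆⇒x≡y w y∈⁅w⁆ = toward x∈Q x≢y
    ... | inj₂ x∈⁅w⁆ | inj₁ y∈Q   with refl ← x∈⁅y⁆⇒x≡y w x∈⁅w⁆ =
      G-sym y x (toward y∈Q (x≢y ∘ sym))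

  ≼-least-simplicial : Symmetric G → ∀ {Q c} → IsMaximalClique G Q →
    (∀ {x} → x ∈ Q → G ⊢ c ≼ x) → IsSimplicial G c
  ≼-least-simplicial G-sym {Q} {c} maxQ@(clique , _) c≼Q x∈N y∈N = clique (N⊆Q x∈N) (N⊆Q y∈N)
    where
    N⊆Q : N G c ⊆ Q
    N⊆Q w∈N = maximalClique-absorbs G-sym maxQ λ x∈Q → c≼Q x∈Q (inj₂ (∈N⇒Adj w∈N))

module _ {n} {G : Graph n} (G-sym : Symmetric G) (nested : NestedNeighbourhoods G) where

  ≼-total-in-clique : ∀ {Q x y} → IsClique G Q → x ∈ Q → y ∈ Q → G ⊢ x ≼ y ⊎ G ⊢ y ≼ x
  ≼-total-in-clique {x = x} {y} clique x∈Q y∈Q with x ≟ᶠ y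
  ... | yes refl = inj₁ id
  ... | no  x≢y  = nested x y (clique x∈Q y∈Q x≢y)

  maximalClique-has-simplicial : ∀ {Q} → IsMaximalClique G Q → Nonempty Q →
    ∃[ v ] (v ∈ Q × IsSimplicial G v)
  maximalClique-has-simplicial {Q} maxQ@(clique , _) ne
    with ∃-least (_∈? Q) {_⊢_≼_ G} (λ w∈N → w∈N) (λ x≼y y≼z → y≼z ∘ x≼y)
              (≼-total-in-clique clique) ne
  ... | c , c∈Q , c≼Q = c , c∈Q , ≼-least-simplicial G-sym maxQ c≼Q

lemma4 : ∀ {n : ℕ} (G : Graph n) → QuasiThreshold G →
    (∀ (Q : Subset n) → IsMaximalClique G Q →
      ∃[ v ] (v ∈ Q × IsSimplicial G v))
    ×
    (∀ (Q : Subset n) → IsMaximalClique G Q →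
      ∀ (S T : Subset n) →
        IsMinimalVertexSeparator G S → S ⊆ Q →
        IsMinimalVertexSeparator G T → T ⊆ Q →
        S ⊆ T ⊎ T ⊆ S)
lemma4 G qt =
  (λ Q maxQ → maximalClique-has-simplicial G-sym nested maxQ
                (maximalClique-nonempty (quasiThreshold⇒vertex qt) maxQ)) ,
  (λ Q (clique , _) S T → minimalSeparators-in-clique-comparable G-sym nested clique)
  where
  G-sym : Symmetric G
  G-sym = quasiThreshold⇒symmetric qt

  nested : NestedNeighbourhoods G
  nested = quasiThreshold⇒nested qt
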